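{- Let $(G,v)$ and $(H,u)$ be rooted graphs with disjoint vertex sets, and let $(I,v)$ be their composition. Then (1) $B^1(I,v)=\min\{B^1(G,v),\,B^1(H,u),\,B^{11}(G,v)+B^0(H,u)\}$; (2) $B^{11}(I,v)=\min\{B^{11}(G,v),\,B^0(H,u)\}$; (3) $B^0(I,v)=\min\{B^0(G,v)+B^{11}(H,u),\,B^0(G,v)+B^0(H,u)\}$.
   Context: A rooted graph $(G,v)$ is a finite simple graph $G$ with a chosen vertex $v$. The composition of $(G,v)$ and $(H,u)$ is the rooted graph $(I,v)$ where $I$ is the disjoint union of $G$ and $H$ plus the new edge $vu$. For a set $W\subseteq V(G)$, vertices in $W$ are white and others black. A final zero blocking set of $G$ is a nonempty $W\subseteq V(G)$ such that no black vertex has exactly one white neighbor. A final $v$-zero blocking set of $(G,v)$ is a set $W\subseteq V(G)$ such that $v\notin W$, $v$ has at least one white neighbor, and every black vertex other than $v$ does not have exactly one white neighbor. Define (with $\min\emptyset=\infty$): $B^1(G,v)=\min\{|W|: v\notin W,\ W\text{ a final zero blocking set of }G\}$; $B^0(G,v)=\min\{|W|: v\in W,\ W\text{ a final zero blocking set of }G\}$; $B^{11}(G,v)=\min\{|W|: v\notin W,\ W\text{ a final } v\text{ -zero blocking set of }G\}$. -}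

module Defs where

open import Data.Bool using (Bool; true; false; _∧_)
open import Data.Nat using (ℕ; zero; suc; _+_; _⊔_)
import Data.Nat as ℕ
open import Data.Fin using (Fin; _↑ˡ_; _↑ʳ_; splitAt; _≟_)
open import Data.Fin.Subset using (Subset; _∈_; _∉_; _∩_; ∣_∣; Nonempty)
open import Data.Fin.Subset.Properties using (_∈?_; nonempty?)
open import Data.Fin.Properties using (all?)
open import Data.Vec using (tabulate)
import Data.Vec as V
open import Data.List using (List; []; _∷_; map; _++_; foldr)
open import Data.Product using (_×_; _,_)
open import Data.Sum using (inj₁; inj₂)
open import Relation.Nullary using (¬_; Dec; yes; no; does)
open import Relation.Nullary.Decidable using (_×-dec_; ¬?)
open import Relation.Unary using (Pred; Decidable)
open import Relation.Binary.PropositionalEquality using (_≡_; _≢_; refl)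
open import Data.Bool.Properties using (∧-comm)
open import Level using (0ℓ)

record Graph (n : ℕ) : Set where
  field
    adj    : Fin n → Fin n → Bool
    sym    : ∀ x y → adj x y ≡ adj y x
    irrefl : ∀ x → adj x x ≡ false
open Graph public

record Rooted : Set where
  constructor rooted
  field
    size  : ℕ
    graph : Graph size
    root  : Fin size
open Rooted public

N : ∀ {n} → Graph n → Fin n → Subset n
N G x = tabulate (adj G x)

whiteNbrs : ∀ {n} → Graph n → Subset n → Fin n → ℕ
whiteNbrs G W x = ∣ W ∩ N G x ∣

FinalZB : ∀ {n} → Graph n → Subset n → Set
FinalZB {n} G W = Nonempty W × (∀ (x : Fin n) → x ∉ W → whiteNbrs G W x ≢ 1)

FinalVZB : ∀ {n} → Graph n → Fin n → Subset n → Set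
FinalVZB {n} G v W =
  v ∉ W × (Nonempty (W ∩ N G v)
          × (∀ (x : Fin n) → x ≢ v → x ∉ W → whiteNbrs G W x ≢ 1))

data ℕ∞ : Set where
  fin : ℕ → ℕ∞
  ∞   : ℕ∞

min∞ : ℕ∞ → ℕ∞ → ℕ∞
min∞ (fin a) (fin b) = fin (a ℕ.⊓ b)
min∞ (fin a) ∞ = fin a
min∞ ∞ y = y

_+∞_ : ℕ∞ → ℕ∞ → ℕ∞
fin a +∞ fin b = fin (a + b)
fin a +∞ ∞ = ∞
∞ +∞ y = ∞

allSubsets : ∀ n → List (Subset n)
allSubsets zero = V.[] ∷ []
allSubsets (suc n) = map (true V.∷_) (allSubsets n) ++ map (false V.∷_) (allSubsets n)

minCard : ∀ {n} (P : Pred (Subset n) 0ℓ) → Decidable P → ℕ∞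
minCard {n} P P? = foldr step ∞ (allSubsets n)
  where
  step : Subset n → ℕ∞ → ℕ∞
  step W r with P? W
  ... | yes _ = min∞ (fin ∣ W ∣) r
  ... | no  _ = r

whiteNbrs≢1? : ∀ {n} (G : Graph n) (W : Subset n) (x : Fin n) → Dec (whiteNbrs G W x ≢ 1)
whiteNbrs≢1? G W x = ¬? (whiteNbrs G W x ℕ.≟ 1)

FinalZB? : ∀ {n} (G : Graph n) → Decidable (FinalZB G)
FinalZB? G W = nonempty? W ×-dec all? (λ x → ∀? x)
  where
  ∀? : ∀ x → Dec (x ∉ _ → _)
  ∀? x with x ∈? W
  ... | yes x∈ = yes (λ x∉ → Data.Empty.⊥-elim (x∉ x∈))
    where import Data.Empty
  ... | no x∉ with whiteNbrs≢1? G W x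
  ...   | yes p = yes (λ _ → p)
  ...   | no ¬p = no (λ f → ¬p (f x∉))

FinalVZB? : ∀ {n} (G : Graph n) (v : Fin n) → Decidable (FinalVZB G v)
FinalVZB? G v W = ¬? (v ∈? W) ×-dec (nonempty? (W ∩ N G v) ×-dec all? ∀?)
  where
  import Data.Empty
  ∀? : ∀ x → Dec (x ≢ v → x ∉ W → whiteNbrs G W x ≢ 1)
  ∀? x with x ≟ v
  ... | yes x≡v = yes (λ x≢v → Data.Empty.⊥-elim (x≢v x≡v))
  ... | no x≢v with x ∈? W
  ...   | yes x∈ = yes (λ _ x∉ → Data.Empty.⊥-elim (x∉ x∈))
  ...   | no x∉ with whiteNbrs≢1? G W x
  ...     | yes p = yes (λ _ _ → p)
  ...     | no ¬p = no (λ f → ¬p (f x≢v x∉))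

B¹ : Rooted → ℕ∞
B¹ (rooted n G v) =
  minCard (λ W → v ∉ W × FinalZB G W) (λ W → ¬? (v ∈? W) ×-dec FinalZB? G W)

B⁰ : Rooted → ℕ∞
B⁰ (rooted n G v) =
  minCard (λ W → v ∈ W × FinalZB G W) (λ W → (v ∈? W) ×-dec FinalZB? G W)

-- (v ∉ W is already part of FinalVZB)
B¹¹ : Rooted → ℕ∞
B¹¹ (rooted n G v) = minCard (FinalVZB G v) (FinalVZB? G v)

b≡ : ∀ {k} → Fin k → Fin k → Bool
b≡ a b = does (a ≟ b)

compAdj : ∀ {m n} → Graph m → Fin m → Graph n → Fin n → Fin (m + n) → Fin (m + n) → Bool
compAdj {m} G v H u x y with splitAt m x | splitAt m y
... | inj₁ a | inj₁ b = adj G a b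
... | inj₂ a | inj₂ b = adj H a b
... | inj₁ a | inj₂ b = b≡ a v ∧ b≡ b u
... | inj₂ a | inj₁ b = b≡ b v ∧ b≡ a u

compose : Rooted → Rooted → Rooted
compose (rooted m G v) (rooted n H u) =
  rooted (m + n) I (v ↑ˡ n)
  where
  I : Graph (m + n)
  adj I = compAdj G v H u
  sym I x y with splitAt m x | splitAt m y
  ... | inj₁ a | inj₁ b = sym G a b
  ... | inj₂ a | inj₂ b = sym H a b
  ... | inj₁ a | inj₂ b = refl
  ... | inj₂ a | inj₁ b = refl
  irrefl I x with splitAt m x
  ... | inj₁ a = irrefl G a
  ... | inj₂ a = irrefl H a

-- Cut a white set of the composition I into xs ++ ys along the vertex sets of G and H.  The only edge
-- between the two halves is vu, so a vertex of G has its white neighbours in G plus, if it is v, one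
-- more exactly when u is white; symmetrically for H.  Recording such an external count e at the root
-- (`Blocking G v e`) makes blocking in I the conjunction of blocking in G and blocking in H, and for a
-- black root e = 0 and e = 1 describe final zero blocking and final v-zero blocking sets respectively.
-- Splitting on the colours of v and u therefore matches the sets counted by B¹, B¹¹ and B⁰ of I with
-- pairs of such sets of G and H (one of them possibly empty), and the three minima follow.
{-# OPTIONS --safe #-}
module Submission where

open import Defs hiding (sym)
open import Data.Bool using (true; false; if_then_else_; _∧_)
open import Data.Bool.Properties using (∧-comm)
open import Data.Empty using (⊥-elim)
open import Data.Fin using (Fin; zero; suc; _↑ˡ_; _↑ʳ_; splitAt; _≟_)
open import Data.Fin.Properties
  using (↑ˡ-injective; splitAt-↑ˡ; splitAt-↑ʳ; splitAt⁻¹-↑ˡ; splitAt⁻¹-↑ʳ)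
open import Data.Fin.Subset using (Subset; _∈_; _∉_; _⊆_; _∩_; ∣_∣; Nonempty; ⊥; ⁅_⁆)
open import Data.Fin.Subset.Properties
  using (_∈?_; nonempty?; Empty-unique; ∣⊥∣≡0; ∣⁅x⁆∣≡1; p⊆q⇒∣p∣≤∣q∣; x∈⁅y⁆⇒x≡y; ∩-zeroˡ; ∉⊥)
open import Data.List using ([]; _∷_; foldr; map)
open import Data.List.Membership.Propositional using () renaming (_∈_ to _∈ₗ_)
open import Data.List.Membership.Propositional.Properties using (∈-++⁺ˡ; ∈-++⁺ʳ; ∈-map⁺)
open import Data.List.Relation.Unary.Any using (here; there)
open import Data.Nat using (ℕ; zero; suc; _+_; _≤_)
open import Data.Nat.Properties
  using (≤-refl; ≤-trans; ≤-antisym; m⊓n≤m; m⊓n≤n; ⊓-glb; ⊓-sel; +-mono-≤; m≤m+n; m≤n+m;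
         n>0⇒n≢0; suc-injective; +-identityʳ; +-assoc; +-comm)
open import Data.Product using (_×_; _,_; proj₁; proj₂; Σ-syntax)
open import Data.Sum using (_⊎_; inj₁; inj₂)
open import Data.Vec using (_∷_; _++_; tabulate; lookup)
import Data.Vec as Vec
open import Data.Vec.Properties
  using (tabulate-cong; zipWith-++; lookup-++ˡ; lookup-++ʳ; []=⇒lookup; lookup⇒[]=)
open import Function using (_∘_)
open import Level using (0ℓ)
open import Relation.Binary.PropositionalEquality
  using (_≡_; _≢_; refl; sym; trans; cong; cong₂; subst; module ≡-Reasoning)
open import Relation.Nullary using (¬_; yes; no)
open import Relation.Nullary.Decidable using (¬?; _×-dec_; dec-true; dec-false)
open import Relation.Unary using (Pred; Decidable)

infix 4 _≤∞_

data _≤∞_ : ℕ∞ → ℕ∞ → Set where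
  fin≤fin : ∀ {a b} → a ≤ b → fin a ≤∞ fin b
  ≤∞-top  : ∀ {a} → a ≤∞ ∞

≤∞-trans : ∀ {a b c} → a ≤∞ b → b ≤∞ c → a ≤∞ c
≤∞-trans (fin≤fin p) (fin≤fin q) = fin≤fin (≤-trans p q)
≤∞-trans _           ≤∞-top      = ≤∞-top

≤∞-antisym : ∀ {a b} → a ≤∞ b → b ≤∞ a → a ≡ b
≤∞-antisym (fin≤fin p) (fin≤fin q) = cong fin (≤-antisym p q)
≤∞-antisym ≤∞-top      ≤∞-top      = refl

≤∞-weakenʳ : ∀ {r a} b → r ≤∞ fin a → r ≤∞ fin (a + b)
≤∞-weakenʳ b r≤a = ≤∞-trans r≤a (fin≤fin (m≤m+n _ b))

≤∞-weakenˡ : ∀ {r b} a → r ≤∞ fin b → r ≤∞ fin (a + b)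
≤∞-weakenˡ a r≤b = ≤∞-trans r≤b (fin≤fin (m≤n+m _ a))

min∞-≤ˡ : ∀ a b → min∞ a b ≤∞ a
min∞-≤ˡ (fin a) (fin b) = fin≤fin (m⊓n≤m a b)
min∞-≤ˡ (fin a) ∞       = fin≤fin ≤-refl
min∞-≤ˡ ∞       b       = ≤∞-top

min∞-≤ʳ : ∀ a b → min∞ a b ≤∞ b
min∞-≤ʳ (fin a) (fin b) = fin≤fin (m⊓n≤n a b)
min∞-≤ʳ (fin a) ∞       = ≤∞-top
min∞-≤ʳ ∞       (fin b) = fin≤fin ≤-refl
min∞-≤ʳ ∞       ∞       = ≤∞-top

min∞-glb : ∀ {a b c} → c ≤∞ a → c ≤∞ b → c ≤∞ min∞ a b
min∞-glb (fin≤fin p) (fin≤fin q) = fin≤fin (⊓-glb p q)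
min∞-glb (fin≤fin p) ≤∞-top      = fin≤fin p
min∞-glb ≤∞-top      q           = q

min∞-sel : ∀ a b → min∞ a b ≡ a ⊎ min∞ a b ≡ b
min∞-sel (fin a) (fin b) with ⊓-sel a b
... | inj₁ eq = inj₁ (cong fin eq)
... | inj₂ eq = inj₂ (cong fin eq)
min∞-sel (fin a) ∞       = inj₁ refl
min∞-sel ∞       b       = inj₂ refl

+∞-mono-≤∞ : ∀ {a b c d} → a ≤∞ b → c ≤∞ d → a +∞ c ≤∞ b +∞ d
+∞-mono-≤∞ (fin≤fin p) (fin≤fin q) = fin≤fin (+-mono-≤ p q)
+∞-mono-≤∞ (fin≤fin p) ≤∞-top      = ≤∞-top
+∞-mono-≤∞ ≤∞-top      _           = ≤∞-top

∈-allSubsets : ∀ {n} (W : Subset n) → W ∈ₗ allSubsets n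
∈-allSubsets {zero}  Vec.[]      = here refl
∈-allSubsets {suc n} (true ∷ W)  = ∈-++⁺ˡ (∈-map⁺ (true ∷_) (∈-allSubsets W))
∈-allSubsets {suc n} (false ∷ W) =
  ∈-++⁺ʳ (map (true ∷_) (allSubsets n)) (∈-map⁺ (false ∷_) (∈-allSubsets W))

module FoldMin {n} {P : Pred (Subset n) 0ℓ} (P? : Decidable P) (step : Subset n → ℕ∞ → ℕ∞)
  (step-yes : ∀ {W} r → P W → step W r ≡ min∞ (fin ∣ W ∣) r)
  (step-no  : ∀ {W} r → ¬ P W → step W r ≡ r)
  where

  foldr-≤ : ∀ {W} L → W ∈ₗ L → P W → foldr step ∞ L ≤∞ fin ∣ W ∣
  foldr-≤ (W ∷ L) (here refl) p
    rewrite step-yes (foldr step ∞ L) p = min∞-≤ˡ (fin ∣ W ∣) (foldr step ∞ L)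
  foldr-≤ (W′ ∷ L) (there W∈L) p with P? W′
  ... | yes p′ rewrite step-yes (foldr step ∞ L) p′ =
    ≤∞-trans (min∞-≤ʳ (fin ∣ W′ ∣) (foldr step ∞ L)) (foldr-≤ L W∈L p)
  ... | no ¬p′ rewrite step-no (foldr step ∞ L) ¬p′ = foldr-≤ L W∈L p

  Attained : ℕ∞ → Set
  Attained r = r ≡ ∞ ⊎ Σ[ W ∈ Subset n ] P W × r ≡ fin ∣ W ∣

  attained-min∞ : ∀ {a b} → Attained a → Attained b → Attained (min∞ a b)
  attained-min∞ {a} {b} att-a att-b with min∞-sel a b
  ... | inj₁ eq = subst Attained (sym eq) att-a
  ... | inj₂ eq = subst Attained (sym eq) att-b

  foldr-attained : ∀ L → Attained (foldr step ∞ L)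
  foldr-attained []      = inj₁ refl
  foldr-attained (W ∷ L) with P? W
  ... | no ¬p rewrite step-no (foldr step ∞ L) ¬p = foldr-attained L
  ... | yes p rewrite step-yes (foldr step ∞ L) p =
    attained-min∞ (inj₂ (W , p , refl)) (foldr-attained L)

-- `minCard` folds a step function local to its definition; it is recovered here by unification.
minCard-step : ∀ {n} (P : Pred (Subset n) 0ℓ) (P? : Decidable P) →
  Σ[ step ∈ (Subset n → ℕ∞ → ℕ∞) ] minCard P P? ≡ foldr step ∞ (allSubsets n)
minCard-step P P? = _ , refl

module _ {n} {P : Pred (Subset n) 0ℓ} (P? : Decidable P) where
  private
    step : Subset n → ℕ∞ → ℕ∞
    step = proj₁ (minCard-step P P?)

    step-yes : ∀ {W} r → P W → step W r ≡ min∞ (fin ∣ W ∣) r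
    step-yes {W} r p with P? W
    ... | yes _ = refl
    ... | no ¬p = ⊥-elim (¬p p)

    step-no : ∀ {W} r → ¬ P W → step W r ≡ r
    step-no {W} r ¬p with P? W
    ... | yes p = ⊥-elim (¬p p)
    ... | no _  = refl

    open FoldMin P? step step-yes step-no

  minCard-≤ : ∀ {W} → P W → minCard P P? ≤∞ fin ∣ W ∣
  minCard-≤ {W} = foldr-≤ (allSubsets n) (∈-allSubsets W)

  minCard-attained : minCard P P? ≡ ∞ ⊎ Σ[ W ∈ Subset n ] P W × minCard P P? ≡ fin ∣ W ∣
  minCard-attained = foldr-attained (allSubsets n)

  minCard-greatest : ∀ {r} → (∀ W → P W → r ≤∞ fin ∣ W ∣) → r ≤∞ minCard P P?
  minCard-greatest bound with minCard-attained
  ... | inj₁ eq           rewrite eq = ≤∞-top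
  ... | inj₂ (W , p , eq) rewrite eq = bound W p

minCard-+-greatest : ∀ {m n} {P : Pred (Subset m) 0ℓ} {Q : Pred (Subset n) 0ℓ}
  (P? : Decidable P) (Q? : Decidable Q) {r} →
  (∀ xs ys → P xs → Q ys → r ≤∞ fin (∣ xs ∣ + ∣ ys ∣)) → r ≤∞ minCard P P? +∞ minCard Q Q?
minCard-+-greatest P? Q? bound with minCard-attained P? | minCard-attained Q?
... | inj₁ eq            | _                   rewrite eq       = ≤∞-top
... | inj₂ (xs , p , eq) | inj₁ eq′            rewrite eq | eq′ = ≤∞-top
... | inj₂ (xs , p , eq) | inj₂ (ys , q , eq′) rewrite eq | eq′ = bound xs ys p q

∣p++q∣≡∣p∣+∣q∣ : ∀ {m n} (p : Subset m) (q : Subset n) → ∣ p ++ q ∣ ≡ ∣ p ∣ + ∣ q ∣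
∣p++q∣≡∣p∣+∣q∣ Vec.[]      q = refl
∣p++q∣≡∣p∣+∣q∣ (true ∷ p)  q = cong suc (∣p++q∣≡∣p∣+∣q∣ p q)
∣p++q∣≡∣p∣+∣q∣ (false ∷ p) q = ∣p++q∣≡∣p∣+∣q∣ p q

∣p++q∩r++s∣ : ∀ {m n} (p r : Subset m) (q s : Subset n) →
  ∣ (p ++ q) ∩ (r ++ s) ∣ ≡ ∣ p ∩ r ∣ + ∣ q ∩ s ∣
∣p++q∩r++s∣ p r q s = trans (cong ∣_∣ (zipWith-++ _∧_ p q r s)) (∣p++q∣≡∣p∣+∣q∣ (p ∩ r) (q ∩ s))

nonempty⇒∣p∣≢0 : ∀ {n} {p : Subset n} → Nonempty p → ∣ p ∣ ≢ 0
nonempty⇒∣p∣≢0 {p = p} (x , x∈p) =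
  n>0⇒n≢0 (subst (_≤ ∣ p ∣) (∣⁅x⁆∣≡1 x) (p⊆q⇒∣p∣≤∣q∣ ⁅x⁆⊆p))
  where
  ⁅x⁆⊆p : ⁅ x ⁆ ⊆ p
  ⁅x⁆⊆p y∈⁅x⁆ = subst (_∈ p) (sym (x∈⁅y⁆⇒x≡y x y∈⁅x⁆)) x∈p

∣p∣≢0⇒nonempty : ∀ {n} {p : Subset n} → ∣ p ∣ ≢ 0 → Nonempty p
∣p∣≢0⇒nonempty {n} {p} ∣p∣≢0 with nonempty? p
... | yes p≠∅ = p≠∅
... | no  p=∅ = ⊥-elim (∣p∣≢0 (trans (cong ∣_∣ (Empty-unique p=∅)) (∣⊥∣≡0 n)))

data SplitView m n : Fin (m + n) → Set where
  left  : ∀ a → SplitView m n (a ↑ˡ n)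
  right : ∀ b → SplitView m n (m ↑ʳ b)

splitView : ∀ m {n} (x : Fin (m + n)) → SplitView m n x
splitView m x with splitAt m x in eq
... | inj₁ a = subst (SplitView m _) (splitAt⁻¹-↑ˡ eq) (left a)
... | inj₂ b = subst (SplitView m _) (splitAt⁻¹-↑ʳ eq) (right b)

↑ˡ≢↑ʳ : ∀ {m n} (a : Fin m) (b : Fin n) → a ↑ˡ n ≢ m ↑ʳ b
↑ˡ≢↑ʳ {m} {n} a b eq
  with trans (sym (splitAt-↑ˡ m a n)) (trans (cong (splitAt m) eq) (splitAt-↑ʳ m n b))
... | ()

∈-resp-lookup : ∀ {m n} {x : Fin m} {y : Fin n} {p : Subset m} {q : Subset n} →
  lookup p x ≡ lookup q y → x ∈ p → y ∈ q
∈-resp-lookup {y = y} {q = q} eq x∈p = lookup⇒[]= y q (trans (sym eq) ([]=⇒lookup x∈p))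

module _ {m n} {p : Subset m} {q : Subset n} where

  x↑ˡ∈p++q⁺ : ∀ {x} → x ∈ p → x ↑ˡ n ∈ p ++ q
  x↑ˡ∈p++q⁺ {x} = ∈-resp-lookup (sym (lookup-++ˡ p q x))

  x↑ˡ∈p++q⁻ : ∀ {x} → x ↑ˡ n ∈ p ++ q → x ∈ p
  x↑ˡ∈p++q⁻ {x} = ∈-resp-lookup (lookup-++ˡ p q x)

  m↑ʳx∈p++q⁺ : ∀ {x} → x ∈ q → m ↑ʳ x ∈ p ++ q
  m↑ʳx∈p++q⁺ {x} = ∈-resp-lookup (sym (lookup-++ʳ p q x))

  m↑ʳx∈p++q⁻ : ∀ {x} → m ↑ʳ x ∈ p ++ q → x ∈ q
  m↑ʳx∈p++q⁻ {x} = ∈-resp-lookup (lookup-++ʳ p q x)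

  nonempty-++⁺ˡ : Nonempty p → Nonempty (p ++ q)
  nonempty-++⁺ˡ (x , x∈p) = x ↑ˡ n , x↑ˡ∈p++q⁺ x∈p

  nonempty-++⁺ʳ : Nonempty q → Nonempty (p ++ q)
  nonempty-++⁺ʳ (x , x∈q) = m ↑ʳ x , m↑ʳx∈p++q⁺ x∈q

nonempty-++⁻ : ∀ {m n} (p : Subset m) (q : Subset n) → Nonempty (p ++ q) → Nonempty p ⊎ Nonempty q
nonempty-++⁻ {m} p q (x , x∈p++q) with splitView m x
... | left a  = inj₁ (a , x↑ˡ∈p++q⁻ x∈p++q)
... | right b = inj₂ (b , m↑ʳx∈p++q⁻ x∈p++q)

module _ {m n} {Q : Pred (Subset (m + n)) 0ℓ} (Q? : Decidable Q) where

  minCard-≤-++ : ∀ (xs : Subset m) (ys : Subset n) → Q (xs ++ ys) →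
    minCard Q Q? ≤∞ fin (∣ xs ∣ + ∣ ys ∣)
  minCard-≤-++ xs ys q =
    subst (λ k → minCard Q Q? ≤∞ fin k) (∣p++q∣≡∣p∣+∣q∣ xs ys) (minCard-≤ Q? q)

  minCard-≤-++⊥ : ∀ (xs : Subset m) → Q (xs ++ ⊥) → minCard Q Q? ≤∞ fin ∣ xs ∣
  minCard-≤-++⊥ xs q with minCard-≤-++ xs ⊥ q
  ... | bound rewrite ∣⊥∣≡0 n | +-identityʳ ∣ xs ∣ = bound

  minCard-≤-⊥++ : ∀ (ys : Subset n) → Q (⊥ ++ ys) → minCard Q Q? ≤∞ fin ∣ ys ∣
  minCard-≤-⊥++ ys q with minCard-≤-++ ⊥ ys q
  ... | bound rewrite ∣⊥∣≡0 m = bound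

  minCard-greatest-++ : ∀ {r} → (∀ xs ys → Q (xs ++ ys) → r ≤∞ fin (∣ xs ∣ + ∣ ys ∣)) →
    r ≤∞ minCard Q Q?
  minCard-greatest-++ {r} bound = minCard-greatest Q? split
    where
    split : ∀ W → Q W → r ≤∞ fin ∣ W ∣
    split W q with Vec.splitAt m W
    ... | xs , ys , refl rewrite ∣p++q∣≡∣p∣+∣q∣ xs ys = bound xs ys q

indicator : ∀ {n} → Subset n → Fin n → ℕ
indicator p x = if lookup p x then 1 else 0

data Indicator {n} (p : Subset n) (x : Fin n) : ℕ → Set where
  member    : x ∈ p → Indicator p x 1
  nonmember : x ∉ p → Indicator p x 0

indicator-≡ : ∀ {n} {p : Subset n} {x k} → Indicator p x k → indicator p x ≡ k
indicator-≡ (member x∈p) rewrite []=⇒lookup x∈p = refl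
indicator-≡ {p = p} {x} (nonmember x∉p) with lookup p x in eq
... | true  = ⊥-elim (x∉p (lookup⇒[]= x p eq))
... | false = refl

∣p∩∅∣≡0 : ∀ {n} (p : Subset n) → ∣ p ∩ tabulate (λ _ → false) ∣ ≡ 0
∣p∩∅∣≡0 Vec.[]      = refl
∣p∩∅∣≡0 (true ∷ p)  = ∣p∩∅∣≡0 p
∣p∩∅∣≡0 (false ∷ p) = ∣p∩∅∣≡0 p

∣p∩≟x∣≡indicator : ∀ {n} (p : Subset n) x → ∣ p ∩ tabulate (λ y → b≡ y x) ∣ ≡ indicator p x
∣p∩≟x∣≡indicator (true ∷ p)  zero    = cong suc (∣p∩∅∣≡0 p)
∣p∩≟x∣≡indicator (false ∷ p) zero    = ∣p∩∅∣≡0 p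
∣p∩≟x∣≡indicator (true ∷ p)  (suc x) = ∣p∩≟x∣≡indicator p x
∣p∩≟x∣≡indicator (false ∷ p) (suc x) = ∣p∩≟x∣≡indicator p x

∣p∩c∧≟x∣ : ∀ {n} c (p : Subset n) x →
  ∣ p ∩ tabulate (λ y → c ∧ b≡ y x) ∣ ≡ (if c then indicator p x else 0)
∣p∩c∧≟x∣ true  p x = ∣p∩≟x∣≡indicator p x
∣p∩c∧≟x∣ false p x = ∣p∩∅∣≡0 p

infix 4 _↦_

_↦_ : ∀ {n} → Fin n → ℕ → Fin n → ℕ
(v ↦ e) x = if b≡ x v then e else 0

↦-self : ∀ {n} (v : Fin n) {e} → (v ↦ e) v ≡ e
↦-self v rewrite dec-true (v ≟ v) refl = refl

module _ {n} {v : Fin n} where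

  ↦-≢ : ∀ {e x} → x ≢ v → (v ↦ e) x ≡ 0
  ↦-≢ {e} {x} x≢v rewrite dec-false (x ≟ v) x≢v = refl

  ↦-zero : ∀ x → (v ↦ 0) x ≡ 0
  ↦-zero x with b≡ x v
  ... | true  = refl
  ... | false = refl

  ↦-+ : ∀ d e x → (v ↦ d) x + (v ↦ e) x ≡ (v ↦ (d + e)) x
  ↦-+ d e x with b≡ x v
  ... | true  = refl
  ... | false = refl

  ↦-≢1 : ∀ {e} x → e ≢ 1 → (v ↦ e) x ≢ 1
  ↦-≢1 x e≢1 with b≡ x v
  ... | true  = e≢1
  ... | false = λ ()

-- The number of white neighbours of `x` when the root `v` has `e` further white neighbours
-- outside `G`.
whiteNbrs⁺ : ∀ {n} → Graph n → Fin n → ℕ → Subset n → Fin n → ℕ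
whiteNbrs⁺ G v e W x = (v ↦ e) x + whiteNbrs G W x

record Blocking {n} (G : Graph n) (v : Fin n) (e : ℕ) (W : Subset n) : Set where
  constructor blocking
  field
    blocks : ∀ x → x ∉ W → whiteNbrs⁺ G v e W x ≢ 1
open Blocking

whiteNbrs-⊥ : ∀ {n} (G : Graph n) x → whiteNbrs G ⊥ x ≡ 0
whiteNbrs-⊥ {n} G x = trans (cong ∣_∣ (∩-zeroˡ (N G x))) (∣⊥∣≡0 n)

module _ {n} {G : Graph n} {v : Fin n} where

  finalZB⇒blocking : ∀ {W} → FinalZB G W → Blocking G v 0 W
  finalZB⇒blocking (_ , block) =
    blocking λ x x∉W → subst (λ k → k + _ ≢ 1) (sym (↦-zero x)) (block x x∉W)

  blocking⇒finalZB : ∀ {W} → Nonempty W → Blocking G v 0 W → FinalZB G W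
  blocking⇒finalZB W≠∅ block =
    W≠∅ , λ x x∉W → subst (λ k → k + _ ≢ 1) (↦-zero x) (blocks block x x∉W)

  finalVZB⇒blocking : ∀ {W} → FinalVZB G v W → Blocking G v 1 W
  finalVZB⇒blocking {W} (_ , nbr≠∅ , block) = blocking blocks′
    where
    blocks′ : ∀ x → x ∉ W → whiteNbrs⁺ G v 1 W x ≢ 1
    blocks′ x x∉W with x ≟ v
    ... | yes refl = nonempty⇒∣p∣≢0 nbr≠∅ ∘ suc-injective
    ... | no  x≢v  = block x x≢v x∉W

  blocking⇒finalVZB : ∀ {W} → v ∉ W → Blocking G v 1 W → FinalVZB G v W
  blocking⇒finalVZB {W} v∉W block = v∉W , ∣p∣≢0⇒nonempty nbr≢0 , λ x x≢v x∉W →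
    subst (λ k → k + whiteNbrs G W x ≢ 1) (↦-≢ x≢v) (blocks block x x∉W)
    where
    nbr≢0 : whiteNbrs G W v ≢ 0
    nbr≢0 nbr≡0 = blocks block v v∉W (cong₂ _+_ (↦-self v) nbr≡0)

  blocking-root∈ : ∀ {W d e} → v ∈ W → Blocking G v d W → Blocking G v e W
  blocking-root∈ {W} v∈W block = blocking λ x x∉W →
    let x≢v = λ x≡v → x∉W (subst (_∈ W) (sym x≡v) v∈W) in
    subst (λ k → k + whiteNbrs G W x ≢ 1) (trans (↦-≢ x≢v) (sym (↦-≢ x≢v))) (blocks block x x∉W)

  blocking-⊥ : ∀ {e} → e ≢ 1 → Blocking G v e ⊥
  blocking-⊥ {e} e≢1 = blocking λ x _ →
    subst (λ k → (v ↦ e) x + k ≢ 1) (sym (whiteNbrs-⊥ G x))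
      (subst (_≢ 1) (sym (+-identityʳ ((v ↦ e) x))) (↦-≢1 x e≢1))

∉×FinalZB? : ∀ {n} (G : Graph n) v → Decidable (λ W → v ∉ W × FinalZB G W)
∉×FinalZB? G v W = ¬? (v ∈? W) ×-dec FinalZB? G W

∈×FinalZB? : ∀ {n} (G : Graph n) v → Decidable (λ W → v ∈ W × FinalZB G W)
∈×FinalZB? G v W = (v ∈? W) ×-dec FinalZB? G W

tabulate-++ : ∀ {A : Set} m {n} (f : Fin (m + n) → A) →
  tabulate f ≡ tabulate (λ a → f (a ↑ˡ n)) ++ tabulate (λ b → f (m ↑ʳ b))
tabulate-++ zero    f = refl
tabulate-++ (suc m) f = cong (f zero ∷_) (tabulate-++ m (f ∘ suc))

module Composition {m n} (G : Graph m) (v : Fin m) (H : Graph n) (u : Fin n) where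

  Gᵥ Hᵤ : Rooted
  Gᵥ = rooted m G v
  Hᵤ = rooted n H u

  I : Graph (m + n)
  I = graph (compose Gᵥ Hᵤ)

  adj-↑ˡ-↑ˡ : ∀ a a′ → adj I (a ↑ˡ n) (a′ ↑ˡ n) ≡ adj G a a′
  adj-↑ˡ-↑ˡ a a′ rewrite splitAt-↑ˡ m a n | splitAt-↑ˡ m a′ n = refl

  adj-↑ˡ-↑ʳ : ∀ a b → adj I (a ↑ˡ n) (m ↑ʳ b) ≡ b≡ a v ∧ b≡ b u
  adj-↑ˡ-↑ʳ a b rewrite splitAt-↑ˡ m a n | splitAt-↑ʳ m n b = refl

  adj-↑ʳ-↑ˡ : ∀ b a → adj I (m ↑ʳ b) (a ↑ˡ n) ≡ b≡ b u ∧ b≡ a v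
  adj-↑ʳ-↑ˡ b a rewrite splitAt-↑ʳ m n b | splitAt-↑ˡ m a n = ∧-comm (b≡ a v) (b≡ b u)

  adj-↑ʳ-↑ʳ : ∀ b b′ → adj I (m ↑ʳ b) (m ↑ʳ b′) ≡ adj H b b′
  adj-↑ʳ-↑ʳ b b′ rewrite splitAt-↑ʳ m n b | splitAt-↑ʳ m n b′ = refl

  N-↑ˡ : ∀ a → N I (a ↑ˡ n) ≡ N G a ++ tabulate (λ b → b≡ a v ∧ b≡ b u)
  N-↑ˡ a = trans (tabulate-++ m (adj I (a ↑ˡ n)))
    (cong₂ _++_ (tabulate-cong (adj-↑ˡ-↑ˡ a)) (tabulate-cong (adj-↑ˡ-↑ʳ a)))

  N-↑ʳ : ∀ b → N I (m ↑ʳ b) ≡ tabulate (λ a → b≡ b u ∧ b≡ a v) ++ N H b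
  N-↑ʳ b = trans (tabulate-++ m (adj I (m ↑ʳ b)))
    (cong₂ _++_ (tabulate-cong (adj-↑ʳ-↑ˡ b)) (tabulate-cong (adj-↑ʳ-↑ʳ b)))

  whiteNbrs-↑ˡ : ∀ xs ys a →
    whiteNbrs I (xs ++ ys) (a ↑ˡ n) ≡ (v ↦ indicator ys u) a + whiteNbrs G xs a
  whiteNbrs-↑ˡ xs ys a = begin
    ∣ (xs ++ ys) ∩ N I (a ↑ˡ n) ∣
      ≡⟨ cong (λ S → ∣ (xs ++ ys) ∩ S ∣) (N-↑ˡ a) ⟩
    ∣ (xs ++ ys) ∩ (N G a ++ tabulate (λ b → b≡ a v ∧ b≡ b u)) ∣
      ≡⟨ ∣p++q∩r++s∣ xs (N G a) ys _ ⟩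
    whiteNbrs G xs a + ∣ ys ∩ tabulate (λ b → b≡ a v ∧ b≡ b u) ∣
      ≡⟨ cong (whiteNbrs G xs a +_) (∣p∩c∧≟x∣ (b≡ a v) ys u) ⟩
    whiteNbrs G xs a + (v ↦ indicator ys u) a
      ≡⟨ +-comm (whiteNbrs G xs a) _ ⟩
    (v ↦ indicator ys u) a + whiteNbrs G xs a ∎
    where open ≡-Reasoning

  whiteNbrs-↑ʳ : ∀ xs ys b →
    whiteNbrs I (xs ++ ys) (m ↑ʳ b) ≡ (u ↦ indicator xs v) b + whiteNbrs H ys b
  whiteNbrs-↑ʳ xs ys b = begin
    ∣ (xs ++ ys) ∩ N I (m ↑ʳ b) ∣
      ≡⟨ cong (λ S → ∣ (xs ++ ys) ∩ S ∣) (N-↑ʳ b) ⟩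
    ∣ (xs ++ ys) ∩ (tabulate (λ a → b≡ b u ∧ b≡ a v) ++ N H b) ∣
      ≡⟨ ∣p++q∩r++s∣ xs _ ys (N H b) ⟩
    ∣ xs ∩ tabulate (λ a → b≡ b u ∧ b≡ a v) ∣ + whiteNbrs H ys b
      ≡⟨ cong (_+ whiteNbrs H ys b) (∣p∩c∧≟x∣ (b≡ b u) xs v) ⟩
    (u ↦ indicator xs v) b + whiteNbrs H ys b ∎
    where open ≡-Reasoning

  ↦-↑ˡ : ∀ e a → (v ↑ˡ n ↦ e) (a ↑ˡ n) ≡ (v ↦ e) a
  ↦-↑ˡ e a with a ≟ v
  ... | yes refl = ↦-self (v ↑ˡ n)
  ... | no  a≢v  = ↦-≢ (a≢v ∘ ↑ˡ-injective n a v)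

  ↦-↑ʳ : ∀ e b → (v ↑ˡ n ↦ e) (m ↑ʳ b) ≡ 0
  ↦-↑ʳ e b = ↦-≢ (λ eq → ↑ˡ≢↑ʳ v b (sym eq))

  whiteNbrs⁺-↑ˡ : ∀ e xs ys a →
    whiteNbrs⁺ I (v ↑ˡ n) e (xs ++ ys) (a ↑ˡ n) ≡ whiteNbrs⁺ G v (e + indicator ys u) xs a
  whiteNbrs⁺-↑ˡ e xs ys a = begin
    (v ↑ˡ n ↦ e) (a ↑ˡ n) + whiteNbrs I (xs ++ ys) (a ↑ˡ n)
      ≡⟨ cong₂ _+_ (↦-↑ˡ e a) (whiteNbrs-↑ˡ xs ys a) ⟩
    (v ↦ e) a + ((v ↦ indicator ys u) a + whiteNbrs G xs a)
      ≡⟨ sym (+-assoc ((v ↦ e) a) _ _) ⟩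
    (v ↦ e) a + (v ↦ indicator ys u) a + whiteNbrs G xs a
      ≡⟨ cong (_+ whiteNbrs G xs a) (↦-+ e (indicator ys u) a) ⟩
    (v ↦ (e + indicator ys u)) a + whiteNbrs G xs a ∎
    where open ≡-Reasoning

  whiteNbrs⁺-↑ʳ : ∀ e xs ys b →
    whiteNbrs⁺ I (v ↑ˡ n) e (xs ++ ys) (m ↑ʳ b) ≡ whiteNbrs⁺ H u (indicator xs v) ys b
  whiteNbrs⁺-↑ʳ e xs ys b = cong₂ _+_ (↦-↑ʳ e b) (whiteNbrs-↑ʳ xs ys b)

  blocking-split : ∀ {e k l xs ys} → Indicator ys u k → Indicator xs v l →
    Blocking I (v ↑ˡ n) e (xs ++ ys) → Blocking G v (e + k) xs × Blocking H u l ys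
  blocking-split {e} {xs = xs} {ys} u∈?ys v∈?xs block
    rewrite sym (indicator-≡ u∈?ys) | sym (indicator-≡ v∈?xs) =
    blocking (λ a a∉xs →
      blocks block (a ↑ˡ n) (a∉xs ∘ x↑ˡ∈p++q⁻) ∘ trans (whiteNbrs⁺-↑ˡ e xs ys a)) ,
    blocking (λ b b∉ys →
      blocks block (m ↑ʳ b) (b∉ys ∘ m↑ʳx∈p++q⁻) ∘ trans (whiteNbrs⁺-↑ʳ e xs ys b))

  blocking-join : ∀ {e k l xs ys} → Indicator ys u k → Indicator xs v l →
    Blocking G v (e + k) xs → Blocking H u l ys → Blocking I (v ↑ˡ n) e (xs ++ ys)
  blocking-join {e} {xs = xs} {ys} u∈?ys v∈?xs blockG blockH
    rewrite sym (indicator-≡ u∈?ys) | sym (indicator-≡ v∈?xs) = blocking blocks′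
    where
    blocks′ : ∀ x → x ∉ xs ++ ys → whiteNbrs⁺ I (v ↑ˡ n) e (xs ++ ys) x ≢ 1
    blocks′ x x∉ with splitView m x
    ... | left a  = blocks blockG a (x∉ ∘ x↑ˡ∈p++q⁺) ∘ trans (sym (whiteNbrs⁺-↑ˡ e xs ys a))
    ... | right b = blocks blockH b (x∉ ∘ m↑ʳx∈p++q⁺) ∘ trans (sym (whiteNbrs⁺-↑ʳ e xs ys b))

  B¹-restrict : ∀ xs ys → v ∉ xs → Nonempty (xs ++ ys) → Blocking I (v ↑ˡ n) 0 (xs ++ ys) →
    (v ∉ xs × FinalZB G xs) ⊎ (u ∉ ys × FinalZB H ys) ⊎ (FinalVZB G v xs × u ∈ ys × FinalZB H ys)
  B¹-restrict xs ys v∉xs W≠∅ block with u ∈? ys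
  ... | yes u∈ys =
    let blockG , blockH = blocking-split (member u∈ys) (nonmember v∉xs) block
    in inj₂ (inj₂ (blocking⇒finalVZB v∉xs blockG , u∈ys , blocking⇒finalZB (u , u∈ys) blockH))
  ... | no u∉ys
    with blocking-split (nonmember u∉ys) (nonmember v∉xs) block | nonempty-++⁻ xs ys W≠∅
  ...   | blockG , _ | inj₁ xs≠∅ = inj₁ (v∉xs , blocking⇒finalZB xs≠∅ blockG)
  ...   | _ , blockH | inj₂ ys≠∅ = inj₂ (inj₁ (u∉ys , blocking⇒finalZB ys≠∅ blockH))

  B¹-compose : B¹ (compose Gᵥ Hᵤ) ≡ min∞ (B¹ Gᵥ) (min∞ (B¹ Hᵤ) (B¹¹ Gᵥ +∞ B⁰ Hᵤ))
  B¹-compose = ≤∞-antisym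
    (min∞-glb (minCard-greatest (∉×FinalZB? G v) λ xs p → minCard-≤-++⊥ I? xs (extendˡ p))
      (min∞-glb (minCard-greatest (∉×FinalZB? H u) λ ys q → minCard-≤-⊥++ I? ys (extendʳ q))
        (minCard-+-greatest (FinalVZB? G v) (∈×FinalZB? H u) λ xs ys p q →
          minCard-≤-++ I? xs ys (extend p q))))
    (minCard-greatest-++ I? lower)
    where
    I? : Decidable (λ W → v ↑ˡ n ∉ W × FinalZB I W)
    I? = ∉×FinalZB? I (v ↑ˡ n)

    extendˡ : ∀ {xs : Subset m} → v ∉ xs × FinalZB G xs → v ↑ˡ n ∉ xs ++ ⊥ × FinalZB I (xs ++ ⊥)
    extendˡ (v∉xs , zb@(xs≠∅ , _)) = v∉xs ∘ x↑ˡ∈p++q⁻ , blocking⇒finalZB (nonempty-++⁺ˡ xs≠∅)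
      (blocking-join (nonmember ∉⊥) (nonmember v∉xs) (finalZB⇒blocking zb) (blocking-⊥ λ ()))

    extendʳ : ∀ {ys : Subset n} → u ∉ ys × FinalZB H ys → v ↑ˡ n ∉ ⊥ ++ ys × FinalZB I (⊥ ++ ys)
    extendʳ (u∉ys , zb@(ys≠∅ , _)) = ∉⊥ ∘ x↑ˡ∈p++q⁻ , blocking⇒finalZB (nonempty-++⁺ʳ ys≠∅)
      (blocking-join (nonmember u∉ys) (nonmember ∉⊥) (blocking-⊥ λ ()) (finalZB⇒blocking zb))

    extend : ∀ {xs ys} → FinalVZB G v xs → u ∈ ys × FinalZB H ys →
      v ↑ˡ n ∉ xs ++ ys × FinalZB I (xs ++ ys)
    extend vzb@(v∉xs , _) (u∈ys , zb) = v∉xs ∘ x↑ˡ∈p++q⁻ , blocking⇒finalZB (nonempty-++⁺ʳ (u , u∈ys))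
      (blocking-join (member u∈ys) (nonmember v∉xs) (finalVZB⇒blocking vzb) (finalZB⇒blocking zb))

    lower : ∀ (xs : Subset m) (ys : Subset n) → v ↑ˡ n ∉ xs ++ ys × FinalZB I (xs ++ ys) →
      min∞ (B¹ Gᵥ) (min∞ (B¹ Hᵤ) (B¹¹ Gᵥ +∞ B⁰ Hᵤ)) ≤∞ fin (∣ xs ∣ + ∣ ys ∣)
    lower xs ys (v′∉ , zb@(W≠∅ , _))
      with B¹-restrict xs ys (v′∉ ∘ x↑ˡ∈p++q⁺) W≠∅ (finalZB⇒blocking zb)
    ... | inj₁ p = ≤∞-trans (min∞-≤ˡ (B¹ Gᵥ) _) (≤∞-weakenʳ ∣ ys ∣ (minCard-≤ (∉×FinalZB? G v) p))
    ... | inj₂ (inj₁ q) = ≤∞-trans (min∞-≤ʳ (B¹ Gᵥ) _)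
      (≤∞-trans (min∞-≤ˡ (B¹ Hᵤ) _) (≤∞-weakenˡ ∣ xs ∣ (minCard-≤ (∉×FinalZB? H u) q)))
    ... | inj₂ (inj₂ (p , q)) = ≤∞-trans (min∞-≤ʳ (B¹ Gᵥ) _) (≤∞-trans (min∞-≤ʳ (B¹ Hᵤ) _)
      (+∞-mono-≤∞ (minCard-≤ (FinalVZB? G v) p) (minCard-≤ (∈×FinalZB? H u) q)))

  B¹¹-restrict : ∀ xs ys → v ∉ xs → Blocking I (v ↑ˡ n) 1 (xs ++ ys) →
    FinalVZB G v xs ⊎ (u ∈ ys × FinalZB H ys)
  B¹¹-restrict xs ys v∉xs block with u ∈? ys
  ... | yes u∈ys = inj₂ (u∈ys , blocking⇒finalZB (u , u∈ys)
    (proj₂ (blocking-split (member u∈ys) (nonmember v∉xs) block)))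
  ... | no  u∉ys = inj₁ (blocking⇒finalVZB v∉xs
    (proj₁ (blocking-split (nonmember u∉ys) (nonmember v∉xs) block)))

  B¹¹-compose : B¹¹ (compose Gᵥ Hᵤ) ≡ min∞ (B¹¹ Gᵥ) (B⁰ Hᵤ)
  B¹¹-compose = ≤∞-antisym
    (min∞-glb (minCard-greatest (FinalVZB? G v) λ xs p → minCard-≤-++⊥ I? xs (extendˡ p))
              (minCard-greatest (∈×FinalZB? H u) λ ys q → minCard-≤-⊥++ I? ys (extendʳ q)))
    (minCard-greatest-++ I? lower)
    where
    I? : Decidable (FinalVZB I (v ↑ˡ n))
    I? = FinalVZB? I (v ↑ˡ n)

    extendˡ : ∀ {xs : Subset m} → FinalVZB G v xs → FinalVZB I (v ↑ˡ n) (xs ++ ⊥)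
    extendˡ vzb@(v∉xs , _) = blocking⇒finalVZB (v∉xs ∘ x↑ˡ∈p++q⁻)
      (blocking-join (nonmember ∉⊥) (nonmember v∉xs) (finalVZB⇒blocking vzb) (blocking-⊥ λ ()))

    extendʳ : ∀ {ys : Subset n} → u ∈ ys × FinalZB H ys → FinalVZB I (v ↑ˡ n) (⊥ ++ ys)
    extendʳ (u∈ys , zb) = blocking⇒finalVZB (∉⊥ ∘ x↑ˡ∈p++q⁻)
      (blocking-join (member u∈ys) (nonmember ∉⊥) (blocking-⊥ λ ()) (finalZB⇒blocking zb))

    lower : ∀ (xs : Subset m) (ys : Subset n) → FinalVZB I (v ↑ˡ n) (xs ++ ys) →
      min∞ (B¹¹ Gᵥ) (B⁰ Hᵤ) ≤∞ fin (∣ xs ∣ + ∣ ys ∣)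
    lower xs ys vzb@(v′∉ , _) with B¹¹-restrict xs ys (v′∉ ∘ x↑ˡ∈p++q⁺) (finalVZB⇒blocking vzb)
    ... | inj₁ p = ≤∞-trans (min∞-≤ˡ (B¹¹ Gᵥ) _) (≤∞-weakenʳ ∣ ys ∣ (minCard-≤ (FinalVZB? G v) p))
    ... | inj₂ q = ≤∞-trans (min∞-≤ʳ (B¹¹ Gᵥ) _) (≤∞-weakenˡ ∣ xs ∣ (minCard-≤ (∈×FinalZB? H u) q))

  B⁰-restrict : ∀ xs ys → v ∈ xs → Blocking I (v ↑ˡ n) 0 (xs ++ ys) →
    (v ∈ xs × FinalZB G xs) × (FinalVZB H u ys ⊎ (u ∈ ys × FinalZB H ys))
  B⁰-restrict xs ys v∈xs block with u ∈? ys
  ... | yes u∈ys =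
    let blockG , blockH = blocking-split (member u∈ys) (member v∈xs) block
    in (v∈xs , blocking⇒finalZB (v , v∈xs) (blocking-root∈ v∈xs blockG)) ,
       inj₂ (u∈ys , blocking⇒finalZB (u , u∈ys) (blocking-root∈ u∈ys blockH))
  ... | no u∉ys =
    let blockG , blockH = blocking-split (nonmember u∉ys) (member v∈xs) block
    in (v∈xs , blocking⇒finalZB (v , v∈xs) blockG) , inj₁ (blocking⇒finalVZB u∉ys blockH)

  B⁰-compose : B⁰ (compose Gᵥ Hᵤ) ≡ min∞ (B⁰ Gᵥ +∞ B¹¹ Hᵤ) (B⁰ Gᵥ +∞ B⁰ Hᵤ)
  B⁰-compose = ≤∞-antisym
    (min∞-glb
      (minCard-+-greatest (∈×FinalZB? G v) (FinalVZB? H u) λ xs ys p q →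
        minCard-≤-++ I? xs ys (extend¹¹ p q))
      (minCard-+-greatest (∈×FinalZB? G v) (∈×FinalZB? H u) λ xs ys p q →
        minCard-≤-++ I? xs ys (extend⁰ p q)))
    (minCard-greatest-++ I? lower)
    where
    I? : Decidable (λ W → v ↑ˡ n ∈ W × FinalZB I W)
    I? = ∈×FinalZB? I (v ↑ˡ n)

    extend¹¹ : ∀ {xs ys} → v ∈ xs × FinalZB G xs → FinalVZB H u ys →
      v ↑ˡ n ∈ xs ++ ys × FinalZB I (xs ++ ys)
    extend¹¹ (v∈xs , zb) vzb@(u∉ys , _) = x↑ˡ∈p++q⁺ v∈xs , blocking⇒finalZB (nonempty-++⁺ˡ (v , v∈xs))
      (blocking-join (nonmember u∉ys) (member v∈xs) (finalZB⇒blocking zb) (finalVZB⇒blocking vzb))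

    extend⁰ : ∀ {xs ys} → v ∈ xs × FinalZB G xs → u ∈ ys × FinalZB H ys →
      v ↑ˡ n ∈ xs ++ ys × FinalZB I (xs ++ ys)
    extend⁰ (v∈xs , zbG) (u∈ys , zbH) = x↑ˡ∈p++q⁺ v∈xs , blocking⇒finalZB (nonempty-++⁺ˡ (v , v∈xs))
      (blocking-join (member u∈ys) (member v∈xs)
        (blocking-root∈ v∈xs (finalZB⇒blocking zbG)) (blocking-root∈ u∈ys (finalZB⇒blocking zbH)))

    lower : ∀ (xs : Subset m) (ys : Subset n) → v ↑ˡ n ∈ xs ++ ys × FinalZB I (xs ++ ys) →
      min∞ (B⁰ Gᵥ +∞ B¹¹ Hᵤ) (B⁰ Gᵥ +∞ B⁰ Hᵤ) ≤∞ fin (∣ xs ∣ + ∣ ys ∣)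
    lower xs ys (v′∈ , zb) with B⁰-restrict xs ys (x↑ˡ∈p++q⁻ v′∈) (finalZB⇒blocking zb)
    ... | p , inj₁ q = ≤∞-trans (min∞-≤ˡ (B⁰ Gᵥ +∞ B¹¹ Hᵤ) _)
      (+∞-mono-≤∞ (minCard-≤ (∈×FinalZB? G v) p) (minCard-≤ (FinalVZB? H u) q))
    ... | p , inj₂ q = ≤∞-trans (min∞-≤ʳ (B⁰ Gᵥ +∞ B¹¹ Hᵤ) _)
      (+∞-mono-≤∞ (minCard-≤ (∈×FinalZB? G v) p) (minCard-≤ (∈×FinalZB? H u) q))

theorem9 : (G H : Rooted) →
    (B¹ (compose G H) ≡ min∞ (B¹ G) (min∞ (B¹ H) (B¹¹ G +∞ B⁰ H)))
    × (B¹¹ (compose G H) ≡ min∞ (B¹¹ G) (B⁰ H))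
    × (B⁰ (compose G H) ≡ min∞ (B⁰ G +∞ B¹¹ H) (B⁰ G +∞ B⁰ H))
theorem9 (rooted m G v) (rooted n H u) = B¹-compose , B¹¹-compose , B⁰-compose
  where open Composition G v H u
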